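{- Let $D$ be the implication digraph of a 2-CNF formula and let $y$ be a literal with $y\rightsquigarrow\overline y$ in $D$. Then there exists a literal $x$ (not necessarily distinct from $y$) such that $y\rightsquigarrow x\rightsquigarrow\overline x\rightsquigarrow\overline y$, where the paths $y\rightsquigarrow x$ and $x\rightsquigarrow\overline x$ are strictly distinct and do not intersect each other (apart from their common endpoint $x$).
   Context: A 2-CNF formula over Boolean variables $x_1,\dots,x_n$ is a conjunction of pairwise distinct clauses $(\xi\lor\eta)$, where $\xi,\eta$ are literals (variables or their negations) with distinct underlying variables. Its implication digraph has the $2n$ literals as vertices and each clause $(\xi\lor\eta)$ gives the edges $\overline\xi\to\eta$ and $\overline\eta\to\xi$ (so it has no loops and no multiple edges). $a\rightsquigarrow b$ means there is a directed path from $a$ to $b$. Two literals are strictly distinct if their underlying variables are distinct. A directed path is strictly distinct if its literals are pairwise strictly distinct, except that for a path from a literal $x$ to its negation $\overline x$ the endpoints $x$ and $\overline x$ are exempt (all other vertices are pairwise strictly distinct). -}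

module Defs where

open import Data.Nat using (ℕ; suc)
open import Data.Fin using (Fin; toℕ; _<_)
open import Data.Bool using (Bool; not)
open import Data.Product using (_×_; _,_; proj₁; ∃; ∃-syntax)
open import Data.Sum using (_⊎_)
open import Data.List using (List; []; _∷_; length; lookup)
open import Data.List.Membership.Propositional using (_∈_)
open import Data.List.Relation.Unary.All using (All)
open import Data.List.Relation.Unary.AllPairs using (AllPairs)
open import Relation.Nullary using (¬_)
open import Relation.Binary.PropositionalEquality using (_≡_; _≢_)

-- A literal over variables x_1..x_n (indexed by Fin n): a variable with a
-- polarity (true = positive literal x_i, false = negated literal ¬x_i).
Lit : ℕ → Set
Lit n = Fin n × Bool

var : ∀ {n} → Lit n → Fin n
var = proj₁

neg : ∀ {n} → Lit n → Lit n
neg (i , b) = (i , not b)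

Clause : ℕ → Set
Clause n = Lit n × Lit n

-- two clauses are the same clause (clauses are unordered disjunctions)
SameClause : ∀ {n} → Clause n → Clause n → Set
SameClause (a , b) (c , d) = ((a ≡ c) × (b ≡ d)) ⊎ ((a ≡ d) × (b ≡ c))

record TwoCNF (n : ℕ) : Set where
  field
    clauses  : List (Clause n)
    proper   : All (λ c → var (proj₁ c) ≢ var (Data.Product.proj₂ c)) clauses
    distinct : AllPairs (λ c d → ¬ SameClause c d) clauses
open TwoCNF public

Edge : ∀ {n} → TwoCNF n → Lit n → Lit n → Set
Edge F a b = ∃[ ξ ] ∃[ η ] ((ξ , η) ∈ clauses F ×
               (((a ≡ neg ξ) × (b ≡ η)) ⊎ ((a ≡ neg η) × (b ≡ ξ))))

data IsPath {n} (F : TwoCNF n) : Lit n → Lit n → List (Lit n) → Set where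
  here : ∀ {a} → IsPath F a a (a ∷ [])
  step : ∀ {a b c vs} → Edge F a b → IsPath F b c vs → IsPath F a c (a ∷ vs)

_⊢_⇝_ : ∀ {n} → TwoCNF n → Lit n → Lit n → Set
F ⊢ a ⇝ b = ∃[ vs ] IsPath F a b vs

Exempt : ∀ {n} (u v : Lit n) (vs : List (Lit n)) → Fin (length vs) → Fin (length vs) → Set
Exempt u v vs i j = (v ≡ neg u) × (toℕ i ≡ 0) × (suc (toℕ j) ≡ length vs)

StrictlyDistinct : ∀ {n} (u v : Lit n) (vs : List (Lit n)) → Set
StrictlyDistinct u v vs =
  ∀ (i j : Fin (length vs)) → i < j → ¬ Exempt u v vs i j →
  var (lookup vs i) ≢ var (lookup vs j)

MeetOnlyAt : ∀ {n} → Lit n → List (Lit n) → List (Lit n) → Set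
MeetOnlyAt x ps qs = ∀ a → a ∈ ps → a ∈ qs → a ≡ x

module Submission where

-- Follow the walk y ⇝ ¬y while maintaining a path from y to the current
-- literal whose literals have pairwise distinct variables; when the next
-- literal repeats one on that path, cut the loop off. The walk cannot simply
-- run to its end, since ¬y shares its variable with y, so at some step the
-- next literal is ¬x for a literal x on the maintained path. The part of that
-- path up to x, and the rest of it closed by the edge to ¬x, are the two
-- required paths, and the contrapositive of y ⇝ x gives ¬x ⇝ ¬y.

open import Defs
open import Data.Nat using (ℕ; suc; s≤s)
open import Data.Product using (_×_; _,_; ∃-syntax)
open import Data.Sum using (_⊎_; inj₁; inj₂)
open import Data.Bool using (true; false)
open import Data.Bool.Properties using (not-involutive)
open import Data.Fin using (Fin; toℕ; zero; suc; _<_)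
open import Data.Fin.Properties using (_≟_)
open import Data.List using (List; []; _∷_; [_]; _++_; _∷ʳ_; length; lookup)
open import Data.List.Properties using (++-assoc)
open import Data.List.Membership.Propositional using (_∈_; _∉_)
open import Data.List.Membership.Propositional.Properties using (∈-lookup; ∈-++⁻)
open import Data.List.Relation.Unary.All as All using (All; []; _∷_)
import Data.List.Relation.Unary.All.Properties as All
open import Data.List.Relation.Unary.Any using (here; there)
open import Data.List.Relation.Unary.AllPairs using (AllPairs; []; _∷_)
import Data.List.Relation.Unary.AllPairs.Properties as AllPairs
open import Data.Empty using (⊥-elim)
open import Function using (_∘_)
open import Relation.Binary using (Rel)
open import Relation.Nullary using (yes; no)
open import Relation.Binary.PropositionalEquality using (_≡_; _≢_; refl; sym; trans; cong; subst)

module _ {a ℓ} {A : Set a} {R : Rel A ℓ} where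

  AllPairs-lookup : ∀ {xs} → AllPairs R xs →
    (i j : Fin (length xs)) → i < j → R (lookup xs i) (lookup xs j)
  AllPairs-lookup (Rx ∷ _)   zero    (suc j) _         = All.lookup Rx (∈-lookup j)
  AllPairs-lookup (_ ∷ Rxs) (suc i) (suc j) (s≤s i<j) = AllPairs-lookup Rxs i j i<j

  AllPairs-++⁻ : ∀ xs {ys} → AllPairs R (xs ++ ys) →
    AllPairs R xs × AllPairs R ys × All (λ x → All (R x) ys) xs
  AllPairs-++⁻ []       Rys         = [] , Rys , []
  AllPairs-++⁻ (x ∷ xs) (Rx ∷ Rxys) =
    let Rxs , Rys , Rxsys = AllPairs-++⁻ xs Rxys
        Rx-xs , Rx-ys     = All.++⁻ xs Rx
    in Rx-xs ∷ Rxs , Rys , Rx-ys ∷ Rxsys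

  AllPairs-∷ʳ⁺ : ∀ {xs y} → AllPairs R xs → All (λ x → R x y) xs → AllPairs R (xs ∷ʳ y)
  AllPairs-∷ʳ⁺ Rxs Rxsy = AllPairs.++⁺ Rxs ([] ∷ []) (All.map (_∷ []) Rxsy)

  AllPairs-prefix : ∀ xs {y zs} → AllPairs R (xs ++ y ∷ zs) → AllPairs R (xs ∷ʳ y)
  AllPairs-prefix xs {y} {zs} Rxyzs =
    let Rxsy , _ = AllPairs-++⁻ (xs ∷ʳ y) (subst (AllPairs R) (sym (++-assoc xs [ y ] zs)) Rxyzs)
    in Rxsy

lookup-∷ʳ-∈ : ∀ {a} {A : Set a} (xs : List A) {x} (j : Fin (length (xs ∷ʳ x))) →
  suc (toℕ j) ≢ length (xs ∷ʳ x) → lookup (xs ∷ʳ x) j ∈ xs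
lookup-∷ʳ-∈ []       zero    not-last = ⊥-elim (not-last refl)
lookup-∷ʳ-∈ (_ ∷ _)  zero    _        = here refl
lookup-∷ʳ-∈ (_ ∷ xs) (suc j) not-last = there (lookup-∷ʳ-∈ xs j (not-last ∘ cong suc))

module _ {n : ℕ} where

  neg-involutive : (a : Lit n) → neg (neg a) ≡ a
  neg-involutive (i , b) = cong (i ,_) (not-involutive b)

  var-neg : (a : Lit n) → var (neg a) ≡ var a
  var-neg (i , b) = refl

  neg-≢ : (a : Lit n) → neg a ≢ a
  neg-≢ (i , true)  ()
  neg-≢ (i , false) ()

  var-≡⇒≡⊎≡neg : (a u : Lit n) → var a ≡ var u → u ≡ a ⊎ u ≡ neg a
  var-≡⇒≡⊎≡neg (i , false) (.i , false) refl = inj₁ refl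
  var-≡⇒≡⊎≡neg (i , false) (.i , true)  refl = inj₂ refl
  var-≡⇒≡⊎≡neg (i , true)  (.i , false) refl = inj₂ refl
  var-≡⇒≡⊎≡neg (i , true)  (.i , true)  refl = inj₁ refl

  Apart : Lit n → Lit n → Set
  Apart a b = var a ≢ var b

  VarDistinct : List (Lit n) → Set
  VarDistinct = AllPairs Apart

  All-Apart⇒∉ : ∀ {a bs} → All (Apart a) bs → a ∉ bs
  All-Apart⇒∉ a#bs a∈bs = All.lookup a#bs a∈bs refl

  MeetOnlyAt-split : ∀ pre (a : Lit n) post → All (λ p → All (Apart p) (a ∷ post)) pre →
    MeetOnlyAt a (pre ∷ʳ a) (a ∷ post ∷ʳ neg a)
  MeetOnlyAt-split pre a post pre#rest z z∈ps z∈qs with ∈-++⁻ pre z∈ps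
  ... | inj₂ (here z≡a) = z≡a
  ... | inj₁ z∈pre with All.lookup pre#rest z∈pre
  ...   | z#a ∷ z#post = ⊥-elim (All-Apart⇒∉ (z#a ∷ All.∷ʳ⁺ z#post z#¬a) z∈qs)
    where
    z#¬a : Apart z (neg a)
    z#¬a z~¬a = z#a (trans z~¬a (var-neg a))

  VarDistinct⇒StrictlyDistinct : ∀ {u v vs} → VarDistinct vs → StrictlyDistinct u v vs
  VarDistinct⇒StrictlyDistinct vs# i j i<j _ = AllPairs-lookup vs# i j i<j

  cycle-StrictlyDistinct : ∀ x ms → VarDistinct (x ∷ ms) →
    StrictlyDistinct x (neg x) (x ∷ ms ∷ʳ neg x)
  cycle-StrictlyDistinct x ms (x#ms ∷ _) zero (suc j) _ not-exempt =
    All.lookup x#ms (lookup-∷ʳ-∈ ms j (not-exempt ∘ λ last → refl , refl , cong suc last))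
  cycle-StrictlyDistinct x ms (x#ms ∷ ms#) (suc i) (suc j) (s≤s i<j) _ =
    AllPairs-lookup (AllPairs-∷ʳ⁺ ms# (All.map (λ x#m → x#m ∘ sym) x#ms)) i j i<j

  data Occurrence : Lit n → List (Lit n) → Set where
    absent   : ∀ {u vs} → All (λ v → Apart v u) vs → Occurrence u vs
    same     : ∀ {u} pre post → Occurrence u (pre ++ u ∷ post)
    opposite : ∀ {a} pre post → Occurrence (neg a) (pre ++ a ∷ post)

  occurrence : ∀ u vs → Occurrence u vs
  occurrence u [] = absent []
  occurrence u (v ∷ vs) with var v ≟ var u
  ... | yes v~u with var-≡⇒≡⊎≡neg v u v~u
  ...   | inj₁ refl = same [] vs
  ...   | inj₂ refl = opposite [] vs
  occurrence u (v ∷ vs) | no v#u with occurrence u vs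
  ...   | absent vs#u       = absent (v#u ∷ vs#u)
  ...   | same pre post     = same (v ∷ pre) post
  ...   | opposite pre post = opposite (v ∷ pre) post

module _ {n : ℕ} (F : TwoCNF n) where

  IsPath-∷ʳ : ∀ {a b c vs} → IsPath F a b vs → Edge F b c → IsPath F a c (vs ∷ʳ c)
  IsPath-∷ʳ here         b→c = step b→c here
  IsPath-∷ʳ (step a→ p) b→c = step a→ (IsPath-∷ʳ p b→c)

  IsPath-split : ∀ {a b c} pre post → IsPath F a c (pre ++ b ∷ post) →
    IsPath F a b (pre ∷ʳ b) × IsPath F b c (b ∷ post)
  IsPath-split []            post here        = here , here
  IsPath-split []            post (step b→ p) = here , step b→ p
  IsPath-split (_ ∷ [])      post (step a→ p) =
    let p₁ , p₂ = IsPath-split [] post p in step a→ p₁ , p₂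
  IsPath-split (_ ∷ v ∷ pre) post (step a→ p) =
    let p₁ , p₂ = IsPath-split (v ∷ pre) post p in step a→ p₁ , p₂

  IsPath-end-∈ : ∀ {a b vs} → IsPath F a b vs → b ∈ vs
  IsPath-end-∈ here       = here refl
  IsPath-end-∈ (step _ p) = there (IsPath-end-∈ p)

  Edge-contraposition : ∀ {a b} → Edge F a b → Edge F (neg b) (neg a)
  Edge-contraposition (ξ , η , ξη∈F , inj₁ (refl , refl)) = ξ , η , ξη∈F , inj₂ (refl , neg-involutive ξ)
  Edge-contraposition (ξ , η , ξη∈F , inj₂ (refl , refl)) = ξ , η , ξη∈F , inj₁ (refl , neg-involutive η)

  IsPath-contraposition : ∀ {a b vs} → IsPath F a b vs → F ⊢ neg b ⇝ neg a
  IsPath-contraposition here       = _ , here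
  IsPath-contraposition (step e p) =
    let _ , q = IsPath-contraposition p in _ , IsPath-∷ʳ q (Edge-contraposition e)

  VarDistinct-IsPath-closed : ∀ {a b vs} → IsPath F a b vs → VarDistinct vs → var a ≡ var b → a ≡ b
  VarDistinct-IsPath-closed here       _          _   = refl
  VarDistinct-IsPath-closed (step _ p) (a#vs ∷ _) a~b = ⊥-elim (All.lookup a#vs (IsPath-end-∈ p) a~b)

  Conclusion : Lit n → Set
  Conclusion y = ∃[ x ] ∃[ ps ] ∃[ qs ]
    ( IsPath F y x ps × IsPath F x (neg x) qs × F ⊢ neg x ⇝ neg y
    × StrictlyDistinct y x ps × StrictlyDistinct x (neg x) qs
    × MeetOnlyAt x ps qs )

  close-at-complement : ∀ {y w} pre a post → IsPath F y w (pre ++ a ∷ post) →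
    VarDistinct (pre ++ a ∷ post) → Edge F w (neg a) → Conclusion y
  close-at-complement pre a post path path# w→¬a =
    let y⇝a , a⇝w              = IsPath-split pre post path
        _ , a∷post# , pre#rest = AllPairs-++⁻ pre path#
    in a , pre ∷ʳ a , a ∷ post ∷ʳ neg a
       , y⇝a , IsPath-∷ʳ a⇝w w→¬a , IsPath-contraposition y⇝a
       , VarDistinct⇒StrictlyDistinct (AllPairs-prefix pre path#)
       , cycle-StrictlyDistinct a post a∷post#
       , MeetOnlyAt-split pre a post pre#rest

  data Progress (y u : Lit n) : Set where
    found    : Conclusion y → Progress y u
    extended : ∀ {vs} → IsPath F y u vs → VarDistinct vs → Progress y u

  extend : ∀ {y w u vs} → IsPath F y w vs → VarDistinct vs → Edge F w u → Progress y u
  extend {u = u} {vs} path path# w→u with occurrence u vs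
  ... | absent vs#u       = extended (IsPath-∷ʳ path w→u) (AllPairs-∷ʳ⁺ path# vs#u)
  ... | same pre post     =
    let y⇝u , _ = IsPath-split pre post path in extended y⇝u (AllPairs-prefix pre path#)
  ... | opposite pre post = found (close-at-complement pre _ post path path# w→u)

  walk : ∀ {y w vs rest} → IsPath F y w vs → VarDistinct vs → IsPath F w (neg y) rest → Conclusion y
  walk {y} path path# here = ⊥-elim (neg-≢ y (sym (VarDistinct-IsPath-closed path path# (sym (var-neg y)))))
  walk path path# (step w→u u⇝¬y) with extend path path# w→u
  ... | found conclusion       = conclusion
  ... | extended path′ path′# = walk path′ path′# u⇝¬y

mainTheorem3 : (n : ℕ) (F : TwoCNF n) (y : Lit n) →
    F ⊢ y ⇝ neg y →
    ∃[ x ] ∃[ ps ] ∃[ qs ]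
    ( IsPath F y x ps × IsPath F x (neg x) qs × F ⊢ neg x ⇝ neg y
    × StrictlyDistinct y x ps × StrictlyDistinct x (neg x) qs
    × MeetOnlyAt x ps qs )
mainTheorem3 n F y (_ , y⇝¬y) = walk F here ([] ∷ []) y⇝¬y
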